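{- Let $X=\{X_1,X_2\}$ be a $\lambda_2$-equitable $2$-partition of $J(n,3)$ with quotient matrix $(p_{ij})$ satisfying $p_{11}\geq p_{22}$ and $p_{11}\geq 2n-7$. Let $\{a,b,c\}$ be a vertex with $\overline{abc}=1$, labelled so that $\overline{ab\ast}\geq\overline{ac\ast}\geq\overline{bc\ast}$, and suppose $\overline{ab\ast}-\overline{ac\ast}=n-4$ and $\overline{ac\ast}=\overline{bc\ast}$. Then $n\leq 6$.
   Context: $J(n,3)$ ($n\geq 6$): vertices are the $3$-subsets of $[n]$, adjacent iff they share exactly two elements; it is $3(n-3)$-regular. An equitable $2$-partition with quotient matrix $(p_{ij})$ means each vertex of $X_i$ has exactly $p_{ij}$ neighbours in $X_j$; $\lambda_2$-equitable means $p_{11}-p_{21}=n-7$. $\overline{u}=1$ if $u\in X_1$, else $0$; $\overline{xyz}=\overline{\{x,y,z\}}$; $\overline{ij\ast}$ is the number of $3$-subsets containing $i,j$ lying in $X_1$. -}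

module Defs where

open import Data.Nat using (ℕ; zero; suc; _+_; _*_; _∸_; _≤_)
open import Data.Nat.Properties using (_≟_)
open import Data.Bool using (Bool; true; false)
import Data.Bool.Properties as BP
open import Data.List using (List; []; _∷_; [_]; map; _++_; length; filter)
open import Data.Vec using (Vec; []; _∷_)
open import Data.Fin using (Fin)
open import Data.Fin.Subset using (Subset; inside; outside; ∣_∣; _∩_; _∪_; ⁅_⁆)
open import Data.Fin.Subset.Properties using (_∈?_)
open import Data.Product using (_×_)
open import Relation.Nullary.Decidable using (_×-dec_)
open import Relation.Binary.PropositionalEquality using (_≡_)

allSubsets : (n : ℕ) → List (Subset n)
allSubsets zero = [ [] ]
allSubsets (suc n) = map (outside ∷_) (allSubsets n) ++ map (inside ∷_) (allSubsets n)

-- a 2-partition of the vertex set of J(n,3) is given by its indicator: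
-- χ s ≡ true  iff  s ∈ X₁  (only the values on 3-subsets matter)
-- number of neighbours in J(n,3) of s lying in the part with indicator value b
nbrCount : {n : ℕ} → (Subset n → Bool) → Bool → Subset n → ℕ
nbrCount {n} χ b s =
  length (filter (λ t → (∣ t ∣ ≟ 3) ×-dec ((∣ s ∩ t ∣ ≟ 2) ×-dec (χ t BP.≟ b))) (allSubsets n))

IsEquitable : {n : ℕ} → (Subset n → Bool) → ℕ → ℕ → ℕ → ℕ → Set
IsEquitable {n} χ p11 p12 p21 p22 =
  (s : Subset n) → ∣ s ∣ ≡ 3 →
    (χ s ≡ true → nbrCount χ true s ≡ p11 × nbrCount χ false s ≡ p12) ×
    (χ s ≡ false → nbrCount χ true s ≡ p21 × nbrCount χ false s ≡ p22)

-- \overline{ij*}: number of 3-subsets containing i and j lying in X₁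
pairCount : {n : ℕ} → (Subset n → Bool) → Fin n → Fin n → ℕ
pairCount {n} χ i j =
  length (filter (λ t → (∣ t ∣ ≟ 3) ×-dec ((i ∈? t) ×-dec ((j ∈? t) ×-dec (χ t BP.≟ true)))) (allSubsets n))

triple : {n : ℕ} → Fin n → Fin n → Fin n → Subset n
triple a b c = ⁅ a ⁆ ∪ ⁅ b ⁆ ∪ ⁅ c ⁆

-- Write s = {a,b,c}. Every neighbour of s in X₁ shares exactly two points with s, hence
-- contains one of the pairs ab, ac, bc, while s itself contains all three; counting gives
-- p₁₁ + 3 ≤ ab* + ac* + bc*. At most n − 2 vertices contain the pair ab, so ab* ≤ n − 2, and
-- then ab* − ac* = n − 4 forces ac* = bc* ≤ 2, whence p₁₁ ≤ n − 1. Together with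
-- p₁₁ ≥ 2n − 7 this leaves n ≤ 6.
module Submission where

open import Defs
open import Algebra.Properties.CommutativeSemigroup using (interchange; xy∙z≈xz∙y)
open import Data.Bool using (Bool; true; false; if_then_else_)
import Data.Bool.Properties as BP
open import Data.Fin using (Fin; zero; suc)
open import Data.Fin.Subset using (Subset; inside; outside; ∣_∣; _∩_; _∪_; ⁅_⁆; ⊥; ⊤; _∈_; _∉_; _⊆_)
open import Data.Fin.Subset.Properties
  using (_∈?_; _⊆?_; ∣p∣≤n; p⊆q⇒∣p∣≤∣q∣; ∈⊤; ∉⊥; ∣⊥∣≡0; ∪-identityˡ; ∪-identityʳ; ∩-identityʳ; ∩-zeroˡ; ∩-idem;
         x∈p∪q⁻; x∈p∪q⁺; x∈⁅x⁆; x∈⁅y⁆⇒x≡y; x≢y⇒x∉⁅y⁆)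
open import Data.List using (List; []; _∷_; map; _++_; length; filter)
open import Data.List.Membership.Propositional using () renaming (_∈_ to _∈ₗ_)
open import Data.List.Membership.Propositional.Properties using (∈-map⁺; ∈-++⁺ˡ; ∈-++⁺ʳ)
open import Data.List.Properties using (map-++; map-∘)
open import Data.List.Relation.Unary.Any using () renaming (here to hereₗ; there to thereₗ)
open import Data.Nat using (ℕ; suc; _+_; _*_; _∸_; _≤_; z≤n; s≤s)
open import Data.Nat.ListAction using (sum)
open import Data.Nat.ListAction.Properties using (sum-++)
open import Data.Nat.Properties
open import Data.Nat.Solver using (module +-*-Solver)
open +-*-Solver using (solve; _:+_; _:*_; _:=_; con)
open import Data.Product using (Σ; _×_; _,_; proj₁; proj₂)
open import Data.Vec using ([]; _∷_; here; there)
open import Data.Sum using (_⊎_; inj₁; inj₂)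
open import Data.Empty using (⊥-elim)
open import Function using (_∘_)
open import Relation.Nullary using (¬_; Dec; yes; no; does)
open import Relation.Nullary.Decidable using (_×-dec_; dec-true; dec-false)
open import Relation.Unary using (Pred; Decidable)
open import Relation.Binary.PropositionalEquality

private
  variable
    A : Set
    P Q : Set
    n : ℕ

indicator : Dec P → ℕ
indicator d = if does d then 1 else 0

indicator-yes : (d : Dec P) → P → indicator d ≡ 1
indicator-yes d p rewrite dec-true d p = refl

indicator-no : (d : Dec P) → ¬ P → indicator d ≡ 0
indicator-no d ¬p rewrite dec-false d ¬p = refl

1≤indicator : (d : Dec P) → P → 1 ≤ indicator d
1≤indicator d p = ≤-reflexive (sym (indicator-yes d p))

indicator≤ : {k : ℕ} (d : Dec P) → (P → 1 ≤ k) → indicator d ≤ k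
indicator≤ (yes p) 1≤k = 1≤k p
indicator≤ (no _)  _   = z≤n

indicator-mono : (P → Q) → (p : Dec P) (q : Dec Q) → indicator p ≤ indicator q
indicator-mono P⇒Q p q = indicator≤ p (1≤indicator q ∘ P⇒Q)

two-of-three : {R : Set} (p : Dec P) (q : Dec Q) (r : Dec R) →
  indicator p + (indicator q + indicator r) ≡ 2 → (P × Q) ⊎ (P × R) ⊎ (Q × R)
two-of-three (yes p) (yes q) _       _  = inj₁ (p , q)
two-of-three (yes p) (no _)  (yes r) _  = inj₂ (inj₁ (p , r))
two-of-three (no _)  (yes q) (yes r) _  = inj₂ (inj₂ (q , r))
two-of-three (yes _) (no _)  (no _)  ()
two-of-three (no _)  (yes _) (no _)  ()
two-of-three (no _)  (no _)  (yes _) ()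
two-of-three (no _)  (no _)  (no _)  ()

length-filter≡sum-indicator : {P : Pred A _} (P? : Decidable P) (xs : List A) →
  length (filter P? xs) ≡ sum (map (indicator ∘ P?) xs)
length-filter≡sum-indicator P? [] = refl
length-filter≡sum-indicator P? (x ∷ xs) with does (P? x)
... | true  = cong suc (length-filter≡sum-indicator P? xs)
... | false = length-filter≡sum-indicator P? xs

sum-map-≡0 : {f : A → ℕ} → (∀ x → f x ≡ 0) → (xs : List A) → sum (map f xs) ≡ 0
sum-map-≡0 f≡0 [] = refl
sum-map-≡0 f≡0 (x ∷ xs) = cong₂ _+_ (f≡0 x) (sum-map-≡0 f≡0 xs)

sum-map-+ : (f g : A → ℕ) (xs : List A) → sum (map (λ x → f x + g x) xs) ≡ sum (map f xs) + sum (map g xs)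
sum-map-+ f g [] = refl
sum-map-+ f g (x ∷ xs) = trans (cong (f x + g x +_) (sum-map-+ f g xs))
  (interchange +-commutativeSemigroup (f x) (g x) _ _)

sum-map-mono-≤ : {f g : A → ℕ} → (∀ x → f x ≤ g x) → (xs : List A) → sum (map f xs) ≤ sum (map g xs)
sum-map-mono-≤ f≤g [] = z≤n
sum-map-mono-≤ f≤g (x ∷ xs) = +-mono-≤ (f≤g x) (sum-map-mono-≤ f≤g xs)

sum-map-mono-≤-gap : {f g : A → ℕ} {x : A} {xs : List A} {k : ℕ} → (∀ y → f y ≤ g y) →
  x ∈ₗ xs → f x + k ≤ g x → sum (map f xs) + k ≤ sum (map g xs)
sum-map-mono-≤-gap {f = f} {g} {xs = _ ∷ xs} {k} f≤g (hereₗ refl) gap = begin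
  f _ + sum (map f xs) + k ≡⟨ xy∙z≈xz∙y +-commutativeSemigroup (f _) _ k ⟩
  f _ + k + sum (map f xs) ≤⟨ +-mono-≤ gap (sum-map-mono-≤ f≤g xs) ⟩
  g _ + sum (map g xs)     ∎
  where open ≤-Reasoning
sum-map-mono-≤-gap {f = f} {g} {xs = y ∷ _} f≤g (thereₗ x∈xs) gap =
  ≤-trans (≤-reflexive (+-assoc (f y) _ _)) (+-mono-≤ (f≤g y) (sum-map-mono-≤-gap f≤g x∈xs gap))

∈-allSubsets : (s : Subset n) → s ∈ₗ allSubsets n
∈-allSubsets [] = hereₗ refl
∈-allSubsets (outside ∷ s) = ∈-++⁺ˡ (∈-map⁺ (outside ∷_) (∈-allSubsets s))
∈-allSubsets {suc n} (inside ∷ s) =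
  ∈-++⁺ʳ (map (outside ∷_) (allSubsets n)) (∈-map⁺ (inside ∷_) (∈-allSubsets s))

sum-allSubsets-suc : (n : ℕ) (f : Subset (suc n) → ℕ) →
  sum (map f (allSubsets (suc n))) ≡
  sum (map (f ∘ (outside ∷_)) (allSubsets n)) + sum (map (f ∘ (inside ∷_)) (allSubsets n))
sum-allSubsets-suc n f = begin
  sum (map f (map (outside ∷_) ss ++ map (inside ∷_) ss))
    ≡⟨ cong sum (map-++ f (map (outside ∷_) ss) _) ⟩
  sum (map f (map (outside ∷_) ss) ++ map f (map (inside ∷_) ss))
    ≡⟨ sum-++ (map f (map (outside ∷_) ss)) _ ⟩
  sum (map f (map (outside ∷_) ss)) + sum (map f (map (inside ∷_) ss))
    ≡⟨ sym (cong₂ _+_ (cong sum (map-∘ ss)) (cong sum (map-∘ ss))) ⟩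
  sum (map (f ∘ (outside ∷_)) ss) + sum (map (f ∘ (inside ∷_)) ss) ∎
  where
  open ≡-Reasoning
  ss = allSubsets n

∣⁅x⁆∪p∩q∣≡ : (x : Fin n) (p q : Subset n) → x ∉ p → ∣ (⁅ x ⁆ ∪ p) ∩ q ∣ ≡ indicator (x ∈? q) + ∣ p ∩ q ∣
∣⁅x⁆∪p∩q∣≡ zero (inside ∷ p) q x∉p = ⊥-elim (x∉p here)
∣⁅x⁆∪p∩q∣≡ zero (outside ∷ p) (inside ∷ q) _ = cong (λ r → suc ∣ r ∩ q ∣) (∪-identityˡ p)
∣⁅x⁆∪p∩q∣≡ zero (outside ∷ p) (outside ∷ q) _ = cong (λ r → ∣ r ∩ q ∣) (∪-identityˡ p)
∣⁅x⁆∪p∩q∣≡ (suc x) (outside ∷ p) (_ ∷ q) x∉p = ∣⁅x⁆∪p∩q∣≡ x p q (x∉p ∘ there)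
∣⁅x⁆∪p∩q∣≡ (suc x) (inside ∷ p) (outside ∷ q) x∉p = ∣⁅x⁆∪p∩q∣≡ x p q (x∉p ∘ there)
∣⁅x⁆∪p∩q∣≡ (suc x) (inside ∷ p) (inside ∷ q) x∉p =
  trans (cong suc (∣⁅x⁆∪p∩q∣≡ x p q (x∉p ∘ there))) (sym (+-suc _ _))

∣⁅x⁆∩q∣≡ : (x : Fin n) (q : Subset n) → ∣ ⁅ x ⁆ ∩ q ∣ ≡ indicator (x ∈? q)
∣⁅x⁆∩q∣≡ {n} x q = begin
  ∣ ⁅ x ⁆ ∩ q ∣                  ≡⟨ cong (λ r → ∣ r ∩ q ∣) (sym (∪-identityʳ ⁅ x ⁆)) ⟩
  ∣ (⁅ x ⁆ ∪ ⊥) ∩ q ∣            ≡⟨ ∣⁅x⁆∪p∩q∣≡ x ⊥ q ∉⊥ ⟩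
  indicator (x ∈? q) + ∣ ⊥ ∩ q ∣ ≡⟨ cong (λ r → indicator (x ∈? q) + ∣ r ∣) (∩-zeroˡ {n} q) ⟩
  indicator (x ∈? q) + ∣ ⊥ {n} ∣ ≡⟨ cong (indicator (x ∈? q) +_) (∣⊥∣≡0 n) ⟩
  indicator (x ∈? q) + 0         ≡⟨ +-identityʳ _ ⟩
  indicator (x ∈? q)             ∎
  where open ≡-Reasoning

∣⁅x⁆∪⁅y⁆∩q∣≡ : {x y : Fin n} (q : Subset n) → x ≢ y →
  ∣ (⁅ x ⁆ ∪ ⁅ y ⁆) ∩ q ∣ ≡ indicator (x ∈? q) + indicator (y ∈? q)
∣⁅x⁆∪⁅y⁆∩q∣≡ {x = x} {y} q x≢y =
  trans (∣⁅x⁆∪p∩q∣≡ x ⁅ y ⁆ q (x≢y⇒x∉⁅y⁆ x≢y)) (cong (_ +_) (∣⁅x⁆∩q∣≡ y q))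

∣triple∩q∣≡ : {a b c : Fin n} (q : Subset n) → a ≢ b → a ≢ c → b ≢ c →
  ∣ triple a b c ∩ q ∣ ≡ indicator (a ∈? q) + (indicator (b ∈? q) + indicator (c ∈? q))
∣triple∩q∣≡ {a = a} {b} {c} q a≢b a≢c b≢c =
  trans (∣⁅x⁆∪p∩q∣≡ a (⁅ b ⁆ ∪ ⁅ c ⁆) q a∉bc) (cong (_ +_) (∣⁅x⁆∪⁅y⁆∩q∣≡ q b≢c))
  where
  a∉bc : a ∉ ⁅ b ⁆ ∪ ⁅ c ⁆
  a∉bc a∈bc with x∈p∪q⁻ ⁅ b ⁆ ⁅ c ⁆ a∈bc
  ... | inj₁ a∈b = a≢b (x∈⁅y⁆⇒x≡y b a∈b)
  ... | inj₂ a∈c = a≢c (x∈⁅y⁆⇒x≡y c a∈c)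

∣p∣≡∣p∩⊤∣ : (p : Subset n) → ∣ p ∣ ≡ ∣ p ∩ ⊤ ∣
∣p∣≡∣p∩⊤∣ p = cong ∣_∣ (sym (∩-identityʳ p))

indicator-∈⊤ : (x : Fin n) → indicator (x ∈? ⊤) ≡ 1
indicator-∈⊤ x = indicator-yes (x ∈? ⊤) ∈⊤

∣⁅x⁆∪⁅y⁆∣≡2 : {x y : Fin n} → x ≢ y → ∣ ⁅ x ⁆ ∪ ⁅ y ⁆ ∣ ≡ 2
∣⁅x⁆∪⁅y⁆∣≡2 {x = x} {y} x≢y rewrite ∣p∣≡∣p∩⊤∣ (⁅ x ⁆ ∪ ⁅ y ⁆) | ∣⁅x⁆∪⁅y⁆∩q∣≡ ⊤ x≢y
  | indicator-∈⊤ x | indicator-∈⊤ y = refl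

∣triple∣≡3 : {a b c : Fin n} → a ≢ b → a ≢ c → b ≢ c → ∣ triple a b c ∣ ≡ 3
∣triple∣≡3 {a = a} {b} {c} a≢b a≢c b≢c rewrite ∣p∣≡∣p∩⊤∣ (triple a b c) | ∣triple∩q∣≡ ⊤ a≢b a≢c b≢c
  | indicator-∈⊤ a | indicator-∈⊤ b | indicator-∈⊤ c = refl

#supersetsOfSize : Subset n → ℕ → ℕ
#supersetsOfSize {n} u m = sum (map (λ t → indicator (u ⊆? t ×-dec ∣ t ∣ ≟ m)) (allSubsets n))

#supersetsOfSize-∣u∣ : (u : Subset n) → #supersetsOfSize u ∣ u ∣ ≡ 1
#supersetsOfSize-∣u∣ [] = refl
#supersetsOfSize-∣u∣ {suc n} (inside ∷ u) = begin
  #supersetsOfSize (inside ∷ u) (suc ∣ u ∣) ≡⟨ sum-allSubsets-suc n _ ⟩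
  _ + #supersetsOfSize u ∣ u ∣              ≡⟨ cong₂ _+_ (sum-map-≡0 (λ _ → refl) (allSubsets n)) (#supersetsOfSize-∣u∣ u) ⟩
  1                                        ∎
  where open ≡-Reasoning
#supersetsOfSize-∣u∣ {suc n} (outside ∷ u) = begin
  #supersetsOfSize (outside ∷ u) ∣ u ∣ ≡⟨ sum-allSubsets-suc n _ ⟩
  #supersetsOfSize u ∣ u ∣ + _         ≡⟨ cong₂ _+_ (#supersetsOfSize-∣u∣ u) (sum-map-≡0 too-large (allSubsets n)) ⟩
  1                                   ∎
  where
  open ≡-Reasoning
  too-large : ∀ t → indicator (u ⊆? t ×-dec suc ∣ t ∣ ≟ ∣ u ∣) ≡ 0
  too-large t = indicator-no (u ⊆? t ×-dec suc ∣ t ∣ ≟ ∣ u ∣)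
    λ (u⊆t , 1+∣t∣≡∣u∣) → <-irrefl (sym 1+∣t∣≡∣u∣) (s≤s (p⊆q⇒∣p∣≤∣q∣ u⊆t))

#supersetsOfSize-suc∣u∣ : (u : Subset n) → #supersetsOfSize u (suc ∣ u ∣) ≡ n ∸ ∣ u ∣
#supersetsOfSize-suc∣u∣ [] = refl
#supersetsOfSize-suc∣u∣ {suc n} (inside ∷ u) = begin
  #supersetsOfSize (inside ∷ u) (2 + ∣ u ∣) ≡⟨ sum-allSubsets-suc n _ ⟩
  _ + #supersetsOfSize u (suc ∣ u ∣)       ≡⟨ cong₂ _+_ (sum-map-≡0 (λ _ → refl) (allSubsets n)) (#supersetsOfSize-suc∣u∣ u) ⟩
  n ∸ ∣ u ∣                               ∎
  where open ≡-Reasoning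
#supersetsOfSize-suc∣u∣ {suc n} (outside ∷ u) = begin
  #supersetsOfSize (outside ∷ u) (suc ∣ u ∣)       ≡⟨ sum-allSubsets-suc n _ ⟩
  #supersetsOfSize u (suc ∣ u ∣) + #supersetsOfSize u ∣ u ∣
    ≡⟨ cong₂ _+_ (#supersetsOfSize-suc∣u∣ u) (#supersetsOfSize-∣u∣ u) ⟩
  n ∸ ∣ u ∣ + 1                                    ≡⟨ +-comm (n ∸ ∣ u ∣) 1 ⟩
  suc (n ∸ ∣ u ∣)                                  ≡⟨ +-∸-assoc 1 (∣p∣≤n u) ⟨
  suc n ∸ ∣ u ∣                                    ∎
  where open ≡-Reasoning

⁅x⁆∪⁅y⁆⊆ : {x y : Fin n} {t : Subset n} → x ∈ t → y ∈ t → ⁅ x ⁆ ∪ ⁅ y ⁆ ⊆ t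
⁅x⁆∪⁅y⁆⊆ {x = x} {y} x∈t y∈t z∈xy with x∈p∪q⁻ ⁅ x ⁆ ⁅ y ⁆ z∈xy
... | inj₁ z∈x rewrite x∈⁅y⁆⇒x≡y x z∈x = x∈t
... | inj₂ z∈y rewrite x∈⁅y⁆⇒x≡y y z∈y = y∈t

module _ (χ : Subset n → Bool) where

  private
    X₁-vertexOn? : (i j : Fin n) (t : Subset n) → Dec (∣ t ∣ ≡ 3 × (i ∈ t × (j ∈ t × χ t ≡ true)))
    X₁-vertexOn? i j t = (∣ t ∣ ≟ 3) ×-dec ((i ∈? t) ×-dec ((j ∈? t) ×-dec (χ t BP.≟ true)))

    pairCount≡sum : (i j : Fin n) → pairCount χ i j ≡ sum (map (indicator ∘ X₁-vertexOn? i j) (allSubsets n))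
    pairCount≡sum i j = length-filter≡sum-indicator (X₁-vertexOn? i j) (allSubsets n)

  pairCount≤n∸2 : {a b : Fin n} → a ≢ b → pairCount χ a b ≤ n ∸ 2
  pairCount≤n∸2 {a} {b} a≢b = begin
    pairCount χ a b                                     ≡⟨ pairCount≡sum a b ⟩
    sum (map (indicator ∘ X₁-vertexOn? a b) (allSubsets n))
      ≤⟨ sum-map-mono-≤ (λ t → indicator-mono ab⊆ (X₁-vertexOn? a b t) (ab ⊆? t ×-dec ∣ t ∣ ≟ 3)) (allSubsets n) ⟩
    #supersetsOfSize ab 3                               ≡⟨ cong (#supersetsOfSize ab ∘ suc) (sym ∣ab∣≡2) ⟩
    #supersetsOfSize ab (suc ∣ ab ∣)                    ≡⟨ #supersetsOfSize-suc∣u∣ ab ⟩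
    n ∸ ∣ ab ∣                                          ≡⟨ cong (n ∸_) ∣ab∣≡2 ⟩
    n ∸ 2                                               ∎
    where
    open ≤-Reasoning
    ab : Subset n
    ab = ⁅ a ⁆ ∪ ⁅ b ⁆
    ∣ab∣≡2 : ∣ ab ∣ ≡ 2
    ∣ab∣≡2 = ∣⁅x⁆∪⁅y⁆∣≡2 a≢b
    ab⊆ : {t : Subset n} → ∣ t ∣ ≡ 3 × (a ∈ t × (b ∈ t × χ t ≡ true)) → ab ⊆ t × ∣ t ∣ ≡ 3
    ab⊆ (∣t∣≡3 , a∈t , b∈t , _) = ⁅x⁆∪⁅y⁆⊆ a∈t b∈t , ∣t∣≡3

  module _ {a b c : Fin n} (a≢b : a ≢ b) (a≢c : a ≢ c) (b≢c : b ≢ c) (χ[abc] : χ (triple a b c) ≡ true) where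

    private
      s : Subset n
      s = triple a b c

      X₁-neighbour? : (t : Subset n) → Dec (∣ t ∣ ≡ 3 × (∣ s ∩ t ∣ ≡ 2 × χ t ≡ true))
      X₁-neighbour? t = (∣ t ∣ ≟ 3) ×-dec ((∣ s ∩ t ∣ ≟ 2) ×-dec (χ t BP.≟ true))

      #ab #ac #bc #pairs : Subset n → ℕ
      #ab = indicator ∘ X₁-vertexOn? a b
      #ac = indicator ∘ X₁-vertexOn? a c
      #bc = indicator ∘ X₁-vertexOn? b c
      #pairs t = #ab t + (#ac t + #bc t)

      1≤#pairs : ∀ {t} → ∣ t ∣ ≡ 3 × (∣ s ∩ t ∣ ≡ 2 × χ t ≡ true) → 1 ≤ #pairs t
      1≤#pairs {t} (∣t∣≡3 , ∣s∩t∣≡2 , χt) with two-of-three (a ∈? t) (b ∈? t) (c ∈? t)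
                                                (trans (sym (∣triple∩q∣≡ t a≢b a≢c b≢c)) ∣s∩t∣≡2)
      ... | inj₁ (a∈t , b∈t) =
        ≤-trans (1≤indicator (X₁-vertexOn? a b t) (∣t∣≡3 , a∈t , b∈t , χt)) (m≤m+n (#ab t) _)
      ... | inj₂ (inj₁ (a∈t , c∈t)) =
        ≤-trans (1≤indicator (X₁-vertexOn? a c t) (∣t∣≡3 , a∈t , c∈t , χt))
                (≤-trans (m≤m+n (#ac t) (#bc t)) (m≤n+m _ (#ab t)))
      ... | inj₂ (inj₂ (b∈t , c∈t)) =
        ≤-trans (1≤indicator (X₁-vertexOn? b c t) (∣t∣≡3 , b∈t , c∈t , χt))
                (≤-trans (m≤n+m (#bc t) (#ac t)) (m≤n+m _ (#ab t)))

      ∣s∣≡3 : ∣ s ∣ ≡ 3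
      ∣s∣≡3 = ∣triple∣≡3 a≢b a≢c b≢c

      ∣s∩s∣≢2 : ∣ s ∩ s ∣ ≢ 2
      ∣s∩s∣≢2 ∣s∩s∣≡2 with () ← trans (sym (trans (cong ∣_∣ (∩-idem s)) ∣s∣≡3)) ∣s∩s∣≡2

      a∈s : a ∈ s
      a∈s = x∈p∪q⁺ (inj₁ (x∈⁅x⁆ a))
      b∈s : b ∈ s
      b∈s = x∈p∪q⁺ (inj₂ (x∈p∪q⁺ (inj₁ (x∈⁅x⁆ b))))
      c∈s : c ∈ s
      c∈s = x∈p∪q⁺ (inj₂ (x∈p∪q⁺ (inj₂ (x∈⁅x⁆ c))))

      X₁-neighbour[s]+3≤#pairs[s] : indicator (X₁-neighbour? s) + 3 ≤ #pairs s
      X₁-neighbour[s]+3≤#pairs[s]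
        rewrite indicator-no (X₁-neighbour? s) (∣s∩s∣≢2 ∘ proj₁ ∘ proj₂)
              | indicator-yes (X₁-vertexOn? a b s) (∣s∣≡3 , a∈s , b∈s , χ[abc])
              | indicator-yes (X₁-vertexOn? a c s) (∣s∣≡3 , a∈s , c∈s , χ[abc])
              | indicator-yes (X₁-vertexOn? b c s) (∣s∣≡3 , b∈s , c∈s , χ[abc]) = ≤-refl

    nbrCount+3≤pairCounts : nbrCount χ true (triple a b c) + 3 ≤ pairCount χ a b + (pairCount χ a c + pairCount χ b c)
    nbrCount+3≤pairCounts = begin
      nbrCount χ true s + 3
        ≡⟨ cong (_+ 3) (length-filter≡sum-indicator X₁-neighbour? (allSubsets n)) ⟩
      sum (map (indicator ∘ X₁-neighbour?) (allSubsets n)) + 3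
        ≤⟨ sum-map-mono-≤-gap (λ t → indicator≤ (X₁-neighbour? t) 1≤#pairs) (∈-allSubsets s) X₁-neighbour[s]+3≤#pairs[s] ⟩
      sum (map #pairs (allSubsets n))
        ≡⟨ trans (sum-map-+ #ab _ (allSubsets n)) (cong (sum (map #ab (allSubsets n)) +_) (sum-map-+ #ac #bc (allSubsets n))) ⟩
      sum (map #ab (allSubsets n)) + (sum (map #ac (allSubsets n)) + sum (map #bc (allSubsets n)))
        ≡⟨ sym (cong₂ _+_ (pairCount≡sum a b) (cong₂ _+_ (pairCount≡sum a c) (pairCount≡sum b c))) ⟩
      pairCount χ a b + (pairCount χ a c + pairCount χ b c) ∎
      where open ≤-Reasoning

pairCount-bounds⇒n≤6 : {n p ab ac bc : ℕ} → 6 ≤ n → ab ≤ n ∸ 2 → ab ≡ ac + (n ∸ 4) → ac ≡ bc →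
  p + 3 ≤ ab + (ac + bc) → 2 * n ≤ p + 7 → n ≤ 6
pairCount-bounds⇒n≤6 {p = p} {ac = ac} (s≤s (s≤s (s≤s (s≤s (s≤s (s≤s {n = k} _)))))) ab≤ refl refl p+3≤ 2n≤ =
  +-monoʳ-≤ 6 (+-cancelˡ-≤ (12 + k) k 0 (begin
    12 + k + k      ≡⟨ solve 1 (λ k → con 12 :+ k :+ k := con 2 :* (con 6 :+ k)) refl k ⟩
    2 * (6 + k)     ≤⟨ 2n≤ ⟩
    p + 7           ≤⟨ +-monoˡ-≤ 7 p≤5+k ⟩
    5 + k + 7       ≡⟨ solve 1 (λ k → con 5 :+ k :+ con 7 := con 12 :+ k :+ con 0) refl k ⟩
    12 + k + 0      ∎))
  where
  open ≤-Reasoning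
  ac≤2 : ac ≤ 2
  ac≤2 = +-cancelʳ-≤ (2 + k) ac 2 ab≤
  p≤5+k : p ≤ 5 + k
  p≤5+k = +-cancelʳ-≤ 3 p (5 + k) (begin
    p + 3                       ≤⟨ p+3≤ ⟩
    ac + (2 + k) + (ac + ac)    ≤⟨ +-mono-≤ (+-monoˡ-≤ (2 + k) ac≤2) (+-mono-≤ ac≤2 ac≤2) ⟩
    2 + (2 + k) + (2 + 2)       ≡⟨ solve 1 (λ k → con 2 :+ (con 2 :+ k) :+ (con 2 :+ con 2) := con 5 :+ k :+ con 3) refl k ⟩
    5 + k + 3                   ∎)

-- Only equitability at {a,b,c} enters.
mainTheorem9 : (n : ℕ) → 6 ≤ n → (χ : Subset n → Bool) → (p11 p12 p21 p22 : ℕ) →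
    IsEquitable χ p11 p12 p21 p22 →
    Σ (Subset n) (λ s → ∣ s ∣ ≡ 3 × χ s ≡ true) →
    Σ (Subset n) (λ s → ∣ s ∣ ≡ 3 × χ s ≡ false) →
    p11 + 7 ≡ p21 + n →
    p22 ≤ p11 →
    2 * n ≤ p11 + 7 →
    (a b c : Fin n) → ¬ a ≡ b → ¬ a ≡ c → ¬ b ≡ c →
    χ (triple a b c) ≡ true →
    pairCount χ a c ≤ pairCount χ a b →
    pairCount χ b c ≤ pairCount χ a c →
    pairCount χ a b ≡ pairCount χ a c + (n ∸ 4) →
    pairCount χ a c ≡ pairCount χ b c →
    n ≤ 6
mainTheorem9 n 6≤n χ p11 p12 p21 p22 equitable _ _ _ _ 2n≤p11+7 a b c a≢b a≢c b≢c χ[abc] _ _ ab≡ac+n-4 ac≡bc =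
  pairCount-bounds⇒n≤6 6≤n (pairCount≤n∸2 χ a≢b) ab≡ac+n-4 ac≡bc p11+3≤pairCounts 2n≤p11+7
  where
  nbrCount≡p11 : nbrCount χ true (triple a b c) ≡ p11
  nbrCount≡p11 = proj₁ (proj₁ (equitable (triple a b c) (∣triple∣≡3 a≢b a≢c b≢c)) χ[abc])
  p11+3≤pairCounts : p11 + 3 ≤ pairCount χ a b + (pairCount χ a c + pairCount χ b c)
  p11+3≤pairCounts = subst (λ m → m + 3 ≤ _) nbrCount≡p11 (nbrCount+3≤pairCounts χ a≢b a≢c b≢c χ[abc])
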